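{- Let $G$ be a strongly connected digraph and let $e$ be a strong bridge of $G$. Then every graph of $S(G,e)$ is strongly connected.
   Context: A strong bridge of a strongly connected digraph is an edge whose removal destroys strong connectivity. For a strong bridge $(x,y)$ of $G$, let $C_1,\dots,C_k$ be the strongly connected components of $G\setminus(x,y)$. For each $C=C_i$, the digraph $C'$ has vertex set $V(C)\cup(\{x,y\}\setminus V(C))$; it contains every edge of $G$ with both endpoints in $C$, an edge $(a,x)$ for every edge $(a,b)$ of $G$ with $a\in C,b\notin C$, an edge $(y,b)$ for every edge $(a,b)$ of $G$ with $a\notin C,b\in C$, and the edge $(x,y)$. Then $S(G,(x,y))=\{C_1',\dots,C_k'\}$. -}

module Defs where

open import Data.Nat using (ℕ)
open import Data.Fin using (Fin)
open import Data.Product using (Σ; ∃; _×_; _,_)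
open import Data.Sum using (_⊎_)
open import Relation.Nullary using (¬_)
open import Relation.Binary.PropositionalEquality using (_≡_; _≢_)
open import Relation.Binary.Construct.Closure.ReflexiveTransitive using (Star)

record Digraph : Set where
  field
    n   : ℕ
    m   : ℕ
    src : Fin m → Fin n
    tgt : Fin m → Fin n

record SubDigraph (n : ℕ) : Set₁ where
  field
    InV : Fin n → Set
    E   : Set
    src : E → Fin n
    tgt : E → Fin n

module _ (G : Digraph) where
  open Digraph G

  Adj : Fin n → Fin n → Set
  Adj a b = Σ (Fin m) λ j → src j ≡ a × tgt j ≡ b

  AdjMinus : Fin m → Fin n → Fin n → Set
  AdjMinus i a b = Σ (Fin m) λ j → j ≢ i × src j ≡ a × tgt j ≡ b

  StronglyConnected : Set
  StronglyConnected = ∀ u v → Star Adj u v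

  StronglyConnectedMinus : Fin m → Set
  StronglyConnectedMinus i = ∀ u v → Star (AdjMinus i) u v

  StrongBridge : Fin m → Set
  StrongBridge i = StronglyConnected × ¬ StronglyConnectedMinus i

  InSCC : Fin m → Fin n → Fin n → Set
  InSCC i r v = Star (AdjMinus i) r v × Star (AdjMinus i) v r

  -- Edges of C' for C = SCC of r in G ∖ e, where e = edge i = (x , y).
  data C'Edge (i : Fin m) (r : Fin n) : Set where
    inner : (j : Fin m) → InSCC i r (src j) → InSCC i r (tgt j) → C'Edge i r
    -- edge (a , x) for an edge (a , b) of G with a ∈ C, b ∉ C
    out   : (j : Fin m) → InSCC i r (src j) → ¬ InSCC i r (tgt j) → C'Edge i r
    -- edge (y , b) for an edge (a , b) of G with a ∉ C, b ∈ C
    into  : (j : Fin m) → ¬ InSCC i r (src j) → InSCC i r (tgt j) → C'Edge i r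
    bridge : C'Edge i r

  C'src : (i : Fin m) (r : Fin n) → C'Edge i r → Fin n
  C'src i r (inner j _ _) = src j
  C'src i r (out j _ _)   = src j
  C'src i r (into j _ _)  = tgt i
  C'src i r bridge        = src i

  C'tgt : (i : Fin m) (r : Fin n) → C'Edge i r → Fin n
  C'tgt i r (inner j _ _) = tgt j
  C'tgt i r (out j _ _)   = src i
  C'tgt i r (into j _ _)  = tgt j
  C'tgt i r bridge        = tgt i

  C' : (i : Fin m) (r : Fin n) → SubDigraph n
  C' i r = record
    { InV = λ v → InSCC i r v ⊎ (v ≡ src i ⊎ v ≡ tgt i)
    ; E   = C'Edge i r
    ; src = C'src i r
    ; tgt = C'tgt i r
    }

module _ {n : ℕ} (H : SubDigraph n) where
  open SubDigraph H

  SubAdj : Fin n → Fin n → Set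
  SubAdj a b = Σ E λ e → src e ≡ a × tgt e ≡ b

  SubStronglyConnected : Set
  SubStronglyConnected = ∀ u v → InV u → InV v → Star SubAdj u v

-- S(G , e) = { C' G i r | r a vertex }: every SCC of G ∖ e is the SCC of
-- some vertex r, so quantifying over r ranges over all of S(G , e).

module Submission where

open import Data.Nat using (ℕ; zero; suc; _<_; _≤_; s≤s⁻¹)
open import Data.Nat.Properties using (≤-refl; ≤-reflexive; <⇒≤; m≤n⇒m≤1+n; m≤n⇒m<n∨m≡n)
open import Data.Fin using (Fin; toℕ; fromℕ<)
open import Data.Fin.Properties using (_≟_; any?; toℕ<n; toℕ-fromℕ<; toℕ-injective)
open import Data.Product using (_×_; _,_; proj₁; proj₂)
open import Data.Sum using (_⊎_; inj₁; inj₂; [_,_])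
open import Function using (id)
open import Relation.Nullary using (Dec; yes; no)
open import Relation.Nullary.Decidable using (_×-dec_; _⊎-dec_; ¬?; map′)
open import Relation.Binary.PropositionalEquality using (_≡_; refl; sym; trans; cong)
open import Relation.Binary.Construct.Closure.ReflexiveTransitive using (Star; ε; _◅_; _◅◅_)

open import Defs

-- Fix the component C of r in G ∖ e, e = (x , y); it suffices that in C'
-- every vertex reaches r and r reaches every vertex. Inside C this is witnessed by
-- paths of G ∖ e, which never leave C. A path of G from r to x can be cut at its
-- first edge leaving C, which becomes an edge (a , x) of C'; dually a path of G from
-- y to r is cut at its last edge entering C, which becomes an edge (y , b); the edge
-- (x , y) closes the cycle through x and y.
-- Cutting a path at the first exit from C requires deciding membership in C, i.e.
-- reachability in the finite digraph G ∖ e, which is decided by Floyd–Warshall.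

module FloydWarshall {n : ℕ} (R : Fin n → Fin n → Set) (R? : ∀ a b → Dec (R a b)) where

  data PathVia< (k : ℕ) : Fin n → Fin n → Set where
    here  : ∀ {a} → PathVia< k a a
    edge  : ∀ {a b} → R a b → PathVia< k a b
    join  : ∀ {a c b} → PathVia< k a c → toℕ c < k → PathVia< k c b → PathVia< k a b

  toStar : ∀ {k a b} → PathVia< k a b → Star R a b
  toStar here         = ε
  toStar (edge ab)    = ab ◅ ε
  toStar (join p _ q) = toStar p ◅◅ toStar q

  fromStar : ∀ {a b} → Star R a b → PathVia< n a b
  fromStar ε        = here
  fromStar (ab ◅ s) = join (edge ab) (toℕ<n _) (fromStar s)

  weaken : ∀ {k a b} → PathVia< k a b → PathVia< (suc k) a b
  weaken here           = here
  weaken (edge ab)      = edge ab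
  weaken (join p c<k q) = join (weaken p) (m≤n⇒m≤1+n c<k) (weaken q)

  PathVia<0⇒≡⊎R : ∀ {a b} → PathVia< 0 a b → a ≡ b ⊎ R a b
  PathVia<0⇒≡⊎R here      = inj₁ refl
  PathVia<0⇒≡⊎R (edge ab) = inj₂ ab
  PathVia<0⇒≡⊎R (join _ () _)

  module Pivot {k : ℕ} (d : Fin n) (d≡k : toℕ d ≡ k) where

    ThroughPivot : Fin n → Fin n → Set
    ThroughPivot a b = PathVia< k a b ⊎ (PathVia< k a d × PathVia< k d b)

    fromThroughPivot : ∀ {a b} → ThroughPivot a b → PathVia< (suc k) a b
    fromThroughPivot (inj₁ p)       = weaken p
    fromThroughPivot (inj₂ (p , q)) = join (weaken p) (≤-reflexive (cong suc d≡k)) (weaken q)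

    joinThroughPivot : ∀ {a c b} → toℕ c < k →
                       ThroughPivot a c → ThroughPivot c b → ThroughPivot a b
    joinThroughPivot c<k (inj₁ p)       (inj₁ q)       = inj₁ (join p c<k q)
    joinThroughPivot c<k (inj₁ p)       (inj₂ (q , s)) = inj₂ (join p c<k q , s)
    joinThroughPivot c<k (inj₂ (p , q)) (inj₁ s)       = inj₂ (p , join q c<k s)
    joinThroughPivot c<k (inj₂ (p , _)) (inj₂ (_ , s)) = inj₂ (p , s)

    -- A path with intermediate vertices < k + 1 visits d = k at most through
    -- one first and one last occurrence.
    toThroughPivot : ∀ {a b} → PathVia< (suc k) a b → ThroughPivot a b
    toThroughPivot here      = inj₁ here
    toThroughPivot (edge ab) = inj₁ (edge ab)
    toThroughPivot (join p c<1+k q) with m≤n⇒m<n∨m≡n (s≤s⁻¹ c<1+k)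
    ... | inj₁ c<k = joinThroughPivot c<k (toThroughPivot p) (toThroughPivot q)
    ... | inj₂ c≡k with toℕ-injective (trans c≡k (sym d≡k))
    ...   | refl = inj₂ ([ id , proj₁ ] (toThroughPivot p) , [ id , proj₂ ] (toThroughPivot q))

  PathVia<-dec : ∀ k → k ≤ n → ∀ a b → Dec (PathVia< k a b)
  PathVia<-dec zero    _   a b =
    map′ [ (λ { refl → here }) , edge ] PathVia<0⇒≡⊎R (a ≟ b ⊎-dec R? a b)
  PathVia<-dec (suc k) k<n a b =
    map′ fromThroughPivot toThroughPivot
         (via a b ⊎-dec (via a d ×-dec via d b))
    where
      d   = fromℕ< k<n
      via = PathVia<-dec k (<⇒≤ k<n)
      open Pivot d (toℕ-fromℕ< k<n)

  Star-dec : ∀ a b → Dec (Star R a b)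
  Star-dec a b = map′ toStar fromStar (PathVia<-dec n ≤-refl a b)

module _ {n : ℕ} (H : SubDigraph n) where
  open SubDigraph H

  hub⇒SubStronglyConnected : ∀ r →
    (∀ u → InV u → Star (SubAdj H) u r) → (∀ v → InV v → Star (SubAdj H) r v) →
    SubStronglyConnected H
  hub⇒SubStronglyConnected r to from u v u∈H v∈H = to u u∈H ◅◅ from v v∈H

module BridgeComponent (G : Digraph) (i : Fin (Digraph.m G)) (r : Fin (Digraph.n G)) where
  open Digraph G

  x y : Fin n
  x = src i
  y = tgt i

  InC : Fin n → Set
  InC = InSCC G i r

  PathC' : Fin n → Fin n → Set
  PathC' = Star (SubAdj (C' G i r))

  AdjMinus-dec : ∀ a b → Dec (AdjMinus G i a b)
  AdjMinus-dec a b = any? λ j → ¬? (j ≟ i) ×-dec (src j ≟ a ×-dec tgt j ≟ b)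

  InC-dec : ∀ v → Dec (InC v)
  InC-dec v = Star-dec r v ×-dec Star-dec v r
    where open FloydWarshall (AdjMinus G i) AdjMinus-dec

  r∈C : InC r
  r∈C = ε , ε

  pathInC : ∀ {a b} → InC a → InC b → Star (AdjMinus G i) a b → PathC' a b
  pathInC a∈C b∈C ε = ε
  pathInC (r→a , a→r) b∈C (e@(j , _ , refl , refl) ◅ s) =
    (inner j (r→a , a→r) c∈C , refl , refl) ◅ pathInC c∈C b∈C s
    where
      c∈C : InC (tgt j)
      c∈C = r→a ◅◅ (e ◅ ε) , s ◅◅ proj₂ b∈C

  reaches-x-backward : ∀ {a b} → Adj G a b →
    (InC b → PathC' b x) → InC a → PathC' a x
  reaches-x-backward (j , refl , refl) b→x a∈C with InC-dec (tgt j)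
  ... | yes b∈C = (inner j a∈C b∈C , refl , refl) ◅ b→x b∈C
  ... | no  b∉C = (out j a∈C b∉C , refl , refl) ◅ ε

  reached-from-y-forward : ∀ {a b} → Adj G a b →
    (InC a → PathC' y a) → InC b → PathC' y b
  reached-from-y-forward (j , refl , refl) y→a b∈C with InC-dec (src j)
  ... | yes a∈C = y→a a∈C ◅◅ ((inner j a∈C b∈C , refl , refl) ◅ ε)
  ... | no  a∉C = (into j a∉C b∈C , refl , refl) ◅ ε

  path-to-x : ∀ {a} → Star (Adj G) a x → InC a → PathC' a x
  path-to-x ε        _ = ε
  path-to-x (e ◅ s)   = reaches-x-backward e (path-to-x s)

  path-from-y : ∀ {b} → Star (Adj G) y b → InC b → PathC' y b
  path-from-y s = go s (λ _ → ε)
    where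
      go : ∀ {a b} → Star (Adj G) a b → (InC a → PathC' y a) → InC b → PathC' y b
      go ε       y→a = y→a
      go (e ◅ s) y→a = go s (reached-from-y-forward e y→a)

  C'-stronglyConnected : StronglyConnected G → SubStronglyConnected (C' G i r)
  C'-stronglyConnected sc = hub⇒SubStronglyConnected (C' G i r) r to-r from-r
    where
      x→y : PathC' x y
      x→y = (bridge , refl , refl) ◅ ε

      r→x : PathC' r x
      r→x = path-to-x (sc r x) r∈C

      y→r : PathC' y r
      y→r = path-from-y (sc y r) r∈C

      to-r : ∀ u → InC u ⊎ (u ≡ x ⊎ u ≡ y) → PathC' u r
      to-r u (inj₁ u∈C)         = pathInC u∈C r∈C (proj₂ u∈C)
      to-r u (inj₂ (inj₁ refl)) = x→y ◅◅ y→r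
      to-r u (inj₂ (inj₂ refl)) = y→r

      from-r : ∀ v → InC v ⊎ (v ≡ x ⊎ v ≡ y) → PathC' r v
      from-r v (inj₁ v∈C)         = pathInC r∈C v∈C (proj₁ v∈C)
      from-r v (inj₂ (inj₁ refl)) = r→x
      from-r v (inj₂ (inj₂ refl)) = r→x ◅◅ x→y

corollary3 : (G : Digraph) (i : Fin (Digraph.m G)) →
    StrongBridge G i →
    (r : Fin (Digraph.n G)) → SubStronglyConnected (C' G i r)
corollary3 G i (G-strong , _) r = BridgeComponent.C'-stronglyConnected G i r G-strong
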